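{- Let $n\in\mathbb{N}$, $m,p\in\mathbb{N}_0$ and $\lambda\in\mathbb{C}$. Then \[ y_{6}(m,n;\lambda,p)=\sum_{k=0}^{n}\sum_{v=0}^{m+n}\frac{\binom{n}{k}^{p}\binom{m+n}{v}}{\binom{m+n}{n}\,n!}\lambda^{k}S(v,n)B_{m+n-v}^{(n)}(k). \]
   Context: $y_6(m,n;\lambda,p)=\frac{1}{n!}\sum_{k=0}^{n}\binom{n}{k}^{p}k^{m}\lambda^{k}$ (with $0^0=1$). $S(v,n)$ are the Stirling numbers of the second kind, defined by $\frac{(e^t-1)^n}{n!}=\sum_{v\ge0}S(v,n)\frac{t^v}{v!}$. The Bernoulli polynomials of order $n$ are defined by $\left(\frac{t}{e^t-1}\right)^n e^{tx}=\sum_{r\ge0}B_r^{(n)}(x)\frac{t^r}{r!}$. -}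

module Defs where

open import Level using (Level)
open import Data.Nat as ℕ using (ℕ; zero; suc; _∸_)
open import Data.Nat.Combinatorics using (_C_)
open import Data.Integer using (+_)
open import Data.Rational as ℚ using (ℚ; 0ℚ; 1ℚ)
open import Data.Fin using (Fin; toℕ)
open import Data.Vec using (Vec; []; _∷_; head; lookup)
open import Algebra.Bundles using (CommutativeRing)

sumℚ : ℕ → (ℕ → ℚ) → ℚ
sumℚ zero    f = f 0
sumℚ (suc n) f = sumℚ n f ℚ.+ f (suc n)

sumFin : (n : ℕ) → (Fin n → ℚ) → ℚ
sumFin zero    f = 0ℚ
sumFin (suc n) f = f Fin.zero ℚ.+ sumFin n (λ i → f (Fin.suc i))
  where import Data.Fin as Fin

-- inverse of a natural number in ℚ (only used at nonzero arguments)
invℕ : ℕ → ℚ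
invℕ zero    = 0ℚ
invℕ (suc k) = + 1 ℚ./ suc k

invFact : ℕ → ℚ
invFact zero    = 1ℚ
invFact (suc k) = invFact k ℚ.* invℕ (suc k)

powℚ : ℚ → ℕ → ℚ
powℚ x zero    = 1ℚ
powℚ x (suc n) = x ℚ.* powℚ x n

fromℕ : ℕ → ℚ
fromℕ k = + k ℚ./ 1

-- Formal power series over ℚ, given by their (ordinary) coefficients:
-- a series Σ a_j t^j is represented by  a : ℕ → ℚ.

Series : Set
Series = ℕ → ℚ

_⊛_ : Series → Series → Series
(a ⊛ b) j = sumℚ j (λ i → a i ℚ.* b (j ∸ i))

oneS : Series
oneS zero    = 1ℚ
oneS (suc _) = 0ℚ

powS : Series → ℕ → Series
powS a zero    = oneS
powS a (suc n) = a ⊛ powS a n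

-- e^{t x} = Σ x^j / j! t^j
expS : ℚ → Series
expS x j = powℚ x j ℚ.* invFact j

expm1S : Series
expm1S zero    = 0ℚ
expm1S (suc j) = invFact (suc j)

expm1OverT : Series
expm1OverT j = invFact (suc j)

-- The multiplicative inverse t/(e^t - 1) of (e^t - 1)/t (constant term 1):
-- b_0 = 1, b_j = - Σ_{i=1}^{j} c_i b_{j-i}, c = expm1OverT.
-- invVec n = b_n ∷ b_{n-1} ∷ ... ∷ b_0
invVec : (n : ℕ) → Vec ℚ (suc n)
invVec zero    = 1ℚ ∷ []
invVec (suc n) = new ∷ v
  where
  v : Vec ℚ (suc n)
  v = invVec n
  new : ℚ
  new = ℚ.- sumFin (suc n) (λ k → expm1OverT (suc (toℕ k)) ℚ.* lookup v k)

tOverExpm1 : Series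
tOverExpm1 j = head (invVec j)

-- Stirling numbers of the second kind:
-- (e^t - 1)^n / n! = Σ_v S(v,n) t^v / v!

stirling2 : ℕ → ℕ → ℚ
stirling2 v n = fromℕ (v ℕ.!) ℚ.* (invFact n ℚ.* powS expm1S n v)

-- Bernoulli polynomials of order n:
-- (t/(e^t-1))^n e^{tx} = Σ_r B_r^{(n)}(x) t^r / r!
bernoulliPoly : (n r : ℕ) → ℚ → ℚ
bernoulliPoly n r x = fromℕ (r ℕ.!) ℚ.* (powS tOverExpm1 n ⊛ expS x) r

module RingOps {c ℓ : Level} (R : CommutativeRing c ℓ) where
  open CommutativeRing R

  sumR : ℕ → (ℕ → Carrier) → Carrier
  sumR zero    f = f 0
  sumR (suc n) f = sumR n f + f (suc n)

  powR : Carrier → ℕ → Carrier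
  powR x zero    = 1#
  powR x (suc n) = x * powR x n

-- y_6(m,n;λ,p) = (1/n!) Σ_{k=0}^n C(n,k)^p k^m λ^k, in a commutative
-- ring R receiving ℚ via a ring homomorphism ι (e.g. R = ℂ).

y6 : {c ℓ : Level} (R : CommutativeRing c ℓ) → (ℚ → CommutativeRing.Carrier R) →
     ℕ → ℕ → CommutativeRing.Carrier R → ℕ → CommutativeRing.Carrier R
y6 R ι m n lam p =
  ι (invFact n) * sumR n (λ k → ι (fromℕ (((n C k) ℕ.^ p) ℕ.* (k ℕ.^ m))) * powR lam k)
  where open CommutativeRing R
        open RingOps R

-- Write N = m + n.  Since (e^t-1)^n = t^n ((e^t-1)/t)^n and t/(e^t-1) is
-- the inverse of (e^t-1)/t, the product of the generating functions
--   (e^t-1)^n / n!  =  Σ_v S(v,n) t^v / v!,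
--   (t/(e^t-1))^n e^{xt}  =  Σ_r B_r^{(n)}(x) t^r / r!
-- equals t^n e^{xt} / n!.  Comparing coefficients of t^N gives the
-- convolution identity
--   Σ_{v=0}^{N} C(N,v) S(v,n) B_{N-v}^{(n)}(x)  =  C(N,n) x^m.
-- Multiplying by C(n,k)^p / (C(N,n) n!) at x = k yields C(n,k)^p k^m / n!,
-- and summing against λ^k (transported along ι into R) gives y₆.

module Submission where

open import Defs
open import Level using (Level)
open import Data.Nat as ℕ using (ℕ; _+_; _∸_; _≤_)
open import Data.Nat.Combinatorics using (_C_)
open import Data.Rational as ℚ using (ℚ)
open import Data.Rational.Base using (+-*-rawRing)
open import Algebra.Bundles using (CommutativeRing)
open import Algebra.Morphism.Structures using (IsRingHomomorphism)

open import Data.Nat using (zero; suc; _!)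
import Data.Nat.Properties as ℕP
open import Data.Nat.Combinatorics using (nCk≡n!/k![n-k]!; k![n∸k]!∣n!)
open import Data.Nat.DivMod using (m/n*n≡m)
open import Data.Integer using (+_)
import Data.Integer.Properties as ℤP
open import Data.Rational using (mkℚ; 0ℚ; 1ℚ)
import Data.Rational.Properties as ℚP
open import Data.Rational.Solver using (module +-*-Solver)
open import Data.Nat.Coprimality using (1-coprimeTo) renaming (sym to coprime-sym)
open import Data.Fin using (Fin; toℕ)
import Data.Fin as Fin
open import Data.Vec using (lookup)
open import Data.Empty using (⊥-elim)
open import Algebra.Bundles using (CommutativeMonoid)
open import Algebra.Properties.CommutativeSemigroup
  (CommutativeMonoid.commutativeSemigroup ℚP.+-0-commutativeMonoid) using (interchange)
open import Relation.Binary.PropositionalEquality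
  using (_≡_; _≢_; refl; sym; trans; cong; cong₂; module ≡-Reasoning)
import Relation.Binary.Reasoning.Setoid as SetoidReasoning

open +-*-Solver using (solve; _:*_; _:=_)

fromℕ-normal : ∀ a → fromℕ a ≡ mkℚ (+ a) 0 (coprime-sym (1-coprimeTo a))
fromℕ-normal a = ℚP.fromℚᵘ-toℚᵘ (mkℚ (+ a) 0 (coprime-sym (1-coprimeTo a)))

fromℕ-* : ∀ a b → fromℕ (a ℕ.* b) ≡ fromℕ a ℚ.* fromℕ b
fromℕ-* a b = sym (begin
  fromℕ a ℚ.* fromℕ b
    ≡⟨ cong₂ ℚ._*_ (fromℕ-normal a) (fromℕ-normal b) ⟩
  (+ a ℤ.* + b) ℚ./ 1
    ≡⟨ cong (ℚ._/ 1) (sym (ℤP.pos-* a b)) ⟩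
  fromℕ (a ℕ.* b) ∎)
  where open ≡-Reasoning
        import Data.Integer as ℤ

fromℕ-^ : ∀ k m → fromℕ (k ℕ.^ m) ≡ powℚ (fromℕ k) m
fromℕ-^ k zero    = refl
fromℕ-^ k (suc m) = trans (fromℕ-* k (k ℕ.^ m)) (cong (fromℕ k ℚ.*_) (fromℕ-^ k m))

invℕ-inverse : ∀ a → a ≢ 0 → invℕ a ℚ.* fromℕ a ≡ 1ℚ
invℕ-inverse zero    a≢0 = ⊥-elim (a≢0 refl)
invℕ-inverse (suc k) _   =
  trans (cong₂ ℚ._*_ (ℚP.fromℚᵘ-toℚᵘ (mkℚ (+ 1) k (1-coprimeTo (suc k)))) (fromℕ-normal (suc k)))
        (ℚP.*-inverseˡ (mkℚ (+ suc k) 0 (coprime-sym (1-coprimeTo (suc k)))))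

invFact-inverse : ∀ a → invFact a ℚ.* fromℕ (a !) ≡ 1ℚ
invFact-inverse zero    = refl
invFact-inverse (suc a) = begin
  (x ℚ.* y) ℚ.* fromℕ (suc a ℕ.* a !)
    ≡⟨ cong ((x ℚ.* y) ℚ.*_) (fromℕ-* (suc a) (a !)) ⟩
  (x ℚ.* y) ℚ.* (z ℚ.* w)
    ≡⟨ solve 4 (λ x y z w → (x :* y) :* (z :* w) := (y :* z) :* (x :* w)) refl x y z w ⟩
  (y ℚ.* z) ℚ.* (x ℚ.* w)
    ≡⟨ cong₂ ℚ._*_ (invℕ-inverse (suc a) (λ ())) (invFact-inverse a) ⟩
  1ℚ ∎
  where
  open ≡-Reasoning
  x y z w : ℚ
  x = invFact a
  y = invℕ (suc a)
  z = fromℕ (suc a)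
  w = fromℕ (a !)

binomial-factorials : ∀ {N v} → v ≤ N → (N C v) ℕ.* (v ! ℕ.* (N ∸ v) !) ≡ N !
binomial-factorials {N} {v} v≤N =
  trans (cong (ℕ._* (v ! ℕ.* (N ∸ v) !)) (nCk≡n!/k![n-k]! v≤N))
        (m/n*n≡m {{ℕP._!*_!≢0 v (N ∸ v)}} (k![n∸k]!∣n! v≤N))

-- Needed to cancel the factor 1/C(m+n,n) of Theorem 14.
binomial-nonzero : ∀ {N v} → v ≤ N → N C v ≢ 0
binomial-nonzero {N} {v} v≤N C≡0 = ℕ.≢-nonZero⁻¹ (N !) {{ℕP._!≢0 N}} (begin
  N !                                ≡⟨ sym (binomial-factorials v≤N) ⟩
  (N C v) ℕ.* (v ! ℕ.* (N ∸ v) !)    ≡⟨ cong (ℕ._* (v ! ℕ.* (N ∸ v) !)) C≡0 ⟩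
  0                                  ∎)
  where open ≡-Reasoning

sum-cong : ∀ n {f g : ℕ → ℚ} → (∀ i → i ≤ n → f i ≡ g i) → sumℚ n f ≡ sumℚ n g
sum-cong zero    f≡g = f≡g 0 ℕ.z≤n
sum-cong (suc n) f≡g =
  cong₂ ℚ._+_ (sum-cong n (λ i i≤n → f≡g i (ℕP.m≤n⇒m≤1+n i≤n))) (f≡g (suc n) ℕP.≤-refl)

sum-head : ∀ n f → sumℚ (suc n) f ≡ f 0 ℚ.+ sumℚ n (λ i → f (suc i))
sum-head zero    f = refl
sum-head (suc n) f =
  trans (cong (ℚ._+ f (suc (suc n))) (sum-head n f)) (ℚP.+-assoc (f 0) _ _)

sum-+ : ∀ n f g → sumℚ n (λ i → f i ℚ.+ g i) ≡ sumℚ n f ℚ.+ sumℚ n g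
sum-+ zero    f g = refl
sum-+ (suc n) f g =
  trans (cong (ℚ._+ (f (suc n) ℚ.+ g (suc n))) (sum-+ n f g))
        (interchange (sumℚ n f) (sumℚ n g) (f (suc n)) (g (suc n)))

sum-*ˡ : ∀ n c f → c ℚ.* sumℚ n f ≡ sumℚ n (λ i → c ℚ.* f i)
sum-*ˡ zero    c f = refl
sum-*ˡ (suc n) c f =
  trans (ℚP.*-distribˡ-+ c _ _) (cong (ℚ._+ (c ℚ.* f (suc n))) (sum-*ˡ n c f))

sum-*ʳ : ∀ n c f → sumℚ n f ℚ.* c ≡ sumℚ n (λ i → f i ℚ.* c)
sum-*ʳ n c f =
  trans (ℚP.*-comm _ c) (trans (sum-*ˡ n c f) (sum-cong n (λ i _ → ℚP.*-comm c (f i))))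

sum-zero : ∀ n → sumℚ n (λ _ → 0ℚ) ≡ 0ℚ
sum-zero zero    = refl
sum-zero (suc n) = cong (ℚ._+ 0ℚ) (sum-zero n)

suc-∸ : ∀ {n i} → i ≤ n → suc n ∸ i ≡ suc (n ∸ i)
suc-∸ i≤n = ℕP.+-∸-assoc 1 i≤n

sum-reverse : ∀ n f → sumℚ n f ≡ sumℚ n (λ i → f (n ∸ i))
sum-reverse zero    f = refl
sum-reverse (suc n) f = begin
  sumℚ (suc n) f
    ≡⟨ sum-head n f ⟩
  f 0 ℚ.+ sumℚ n (λ i → f (suc i))
    ≡⟨ cong (f 0 ℚ.+_) (sum-reverse n (λ i → f (suc i))) ⟩
  f 0 ℚ.+ sumℚ n (λ i → f (suc (n ∸ i)))
    ≡⟨ ℚP.+-comm (f 0) _ ⟩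
  sumℚ n (λ i → f (suc (n ∸ i))) ℚ.+ f 0
    ≡⟨ cong₂ ℚ._+_ (sum-cong n (λ i i≤n → cong f (sym (suc-∸ i≤n))))
                   (cong f (sym (ℕP.n∸n≡0 n))) ⟩
  sumℚ (suc n) (λ i → f (suc n ∸ i)) ∎
  where open ≡-Reasoning

sum-triangle : ∀ n (g : ℕ → ℕ → ℚ) →
  sumℚ n (λ i → sumℚ (n ∸ i) (g i)) ≡ sumℚ n (λ s → sumℚ s (λ i → g i (s ∸ i)))
sum-triangle zero    g = refl
sum-triangle (suc n) g = begin
  sumℚ n (λ i → sumℚ (suc n ∸ i) (g i)) ℚ.+ sumℚ (n ∸ n) (g (suc n))
    ≡⟨ cong₂ ℚ._+_ (sum-cong n (λ i i≤n → longer-row i≤n (g i)))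
                   (cong (λ z → sumℚ z (g (suc n))) (ℕP.n∸n≡0 n)) ⟩
  sumℚ n (λ i → rows i ℚ.+ g i (suc n ∸ i)) ℚ.+ g (suc n) 0
    ≡⟨ cong (ℚ._+ g (suc n) 0) (sum-+ n rows (λ i → g i (suc n ∸ i))) ⟩
  (sumℚ n rows ℚ.+ sumℚ n (λ i → g i (suc n ∸ i))) ℚ.+ g (suc n) 0
    ≡⟨ ℚP.+-assoc (sumℚ n rows) _ _ ⟩
  sumℚ n rows ℚ.+ (sumℚ n (λ i → g i (suc n ∸ i)) ℚ.+ g (suc n) 0)
    ≡⟨ cong₂ ℚ._+_ (sum-triangle n g)
                   (cong (λ z → sumℚ n (λ i → g i (suc n ∸ i)) ℚ.+ g (suc n) z) (sym (ℕP.n∸n≡0 n))) ⟩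
  sumℚ n (λ s → sumℚ s (λ i → g i (s ∸ i))) ℚ.+ sumℚ (suc n) (λ i → g i (suc n ∸ i)) ∎
  where
  open ≡-Reasoning
  rows : ℕ → ℚ
  rows i = sumℚ (n ∸ i) (g i)
  longer-row : ∀ {i} → i ≤ n → ∀ h → sumℚ (suc n ∸ i) h ≡ sumℚ (n ∸ i) h ℚ.+ h (suc n ∸ i)
  longer-row i≤n h rewrite suc-∸ i≤n = refl

infix  4 _≈S_
infixr 5 _⟫_

_≈S_ : Series → Series → Set
a ≈S b = ∀ j → a j ≡ b j

_⟫_ : ∀ {a b c} → a ≈S b → b ≈S c → a ≈S c
(a≈b ⟫ b≈c) j = trans (a≈b j) (b≈c j)

symS : ∀ {a b} → a ≈S b → b ≈S a
symS a≈b j = sym (a≈b j)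

⊛-cong : ∀ {a a′ b b′} → a ≈S a′ → b ≈S b′ → (a ⊛ b) ≈S (a′ ⊛ b′)
⊛-cong a≈a′ b≈b′ j = sum-cong j (λ i _ → cong₂ ℚ._*_ (a≈a′ i) (b≈b′ (j ∸ i)))

⊛-congˡ : ∀ a {b b′} → b ≈S b′ → (a ⊛ b) ≈S (a ⊛ b′)
⊛-congˡ a = ⊛-cong {a} (λ _ → refl)

⊛-congʳ : ∀ {a a′} b → a ≈S a′ → (a ⊛ b) ≈S (a′ ⊛ b)
⊛-congʳ b a≈a′ = ⊛-cong {b = b} a≈a′ (λ _ → refl)

⊛-comm : ∀ a b → (a ⊛ b) ≈S (b ⊛ a)
⊛-comm a b j = trans (sum-reverse j _) (sum-cong j λ i i≤j →
  trans (cong (λ x → a (j ∸ i) ℚ.* b x) (ℕP.m∸[m∸n]≡n i≤j)) (ℚP.*-comm (a (j ∸ i)) (b i)))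

⊛-assoc : ∀ a b c → ((a ⊛ b) ⊛ c) ≈S (a ⊛ (b ⊛ c))
⊛-assoc a b c j = begin
  sumℚ j (λ s → sumℚ s (λ i → a i ℚ.* b (s ∸ i)) ℚ.* c (j ∸ s))
    ≡⟨ sum-cong j (λ s _ → sum-*ʳ s (c (j ∸ s)) (λ i → a i ℚ.* b (s ∸ i))) ⟩
  sumℚ j (λ s → sumℚ s (λ i → (a i ℚ.* b (s ∸ i)) ℚ.* c (j ∸ s)))
    ≡⟨ sum-cong j (λ s _ → sum-cong s (λ i i≤s →
         trans (ℚP.*-assoc (a i) (b (s ∸ i)) (c (j ∸ s)))
               (cong (λ z → a i ℚ.* (b (s ∸ i) ℚ.* c z)) (sym (∸-∸ i≤s))))) ⟩
  sumℚ j (λ s → sumℚ s (λ i → a i ℚ.* (b (s ∸ i) ℚ.* c (j ∸ i ∸ (s ∸ i)))))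
    ≡⟨ sym (sum-triangle j (λ i l → a i ℚ.* (b l ℚ.* c (j ∸ i ∸ l)))) ⟩
  sumℚ j (λ i → sumℚ (j ∸ i) (λ l → a i ℚ.* (b l ℚ.* c (j ∸ i ∸ l))))
    ≡⟨ sum-cong j (λ i _ → sym (sum-*ˡ (j ∸ i) (a i) (λ l → b l ℚ.* c (j ∸ i ∸ l)))) ⟩
  sumℚ j (λ i → a i ℚ.* sumℚ (j ∸ i) (λ l → b l ℚ.* c (j ∸ i ∸ l))) ∎
  where
  open ≡-Reasoning
  ∸-∸ : ∀ {i s} → i ≤ s → j ∸ i ∸ (s ∸ i) ≡ j ∸ s
  ∸-∸ {i} {s} i≤s = trans (ℕP.∸-+-assoc j i (s ∸ i)) (cong (j ∸_) (ℕP.m+[n∸m]≡n i≤s))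

⊛-identityˡ : ∀ a → (oneS ⊛ a) ≈S a
⊛-identityˡ a zero    = ℚP.*-identityˡ (a 0)
⊛-identityˡ a (suc j) = begin
  sumℚ (suc j) (λ i → oneS i ℚ.* a (suc j ∸ i))
    ≡⟨ sum-head j _ ⟩
  1ℚ ℚ.* a (suc j) ℚ.+ sumℚ j (λ i → 0ℚ ℚ.* a (j ∸ i))
    ≡⟨ cong₂ ℚ._+_ (ℚP.*-identityˡ (a (suc j)))
                   (trans (sum-cong j (λ i _ → ℚP.*-zeroˡ (a (j ∸ i)))) (sum-zero j)) ⟩
  a (suc j) ℚ.+ 0ℚ
    ≡⟨ ℚP.+-identityʳ (a (suc j)) ⟩
  a (suc j) ∎
  where open ≡-Reasoning

powS-cong : ∀ {a b} n → a ≈S b → powS a n ≈S powS b n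
powS-cong zero    a≈b j = refl
powS-cong (suc n) a≈b   = ⊛-cong a≈b (powS-cong n a≈b)

⊛-interchange : ∀ a b A B → ((a ⊛ b) ⊛ (A ⊛ B)) ≈S ((a ⊛ A) ⊛ (b ⊛ B))
⊛-interchange a b A B =
  ⊛-assoc a b (A ⊛ B) ⟫
  ⊛-congˡ a (symS (⊛-assoc b A B) ⟫ ⊛-congʳ B (⊛-comm b A) ⟫ ⊛-assoc A b B) ⟫
  symS (⊛-assoc a A (b ⊛ B))

powS-inverse : ∀ {a b} n → (a ⊛ b) ≈S oneS → (powS a n ⊛ powS b n) ≈S oneS
powS-inverse         zero    ab≈1 = ⊛-identityˡ oneS
powS-inverse {a} {b} (suc n) ab≈1 =
  ⊛-interchange a (powS a n) b (powS b n) ⟫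
  ⊛-cong ab≈1 (powS-inverse n ab≈1) ⟫
  ⊛-identityˡ oneS

shift : Series → Series
shift a zero    = 0ℚ
shift a (suc j) = a j

shiftN : ℕ → Series → Series
shiftN zero    a = a
shiftN (suc n) a = shift (shiftN n a)

shift-cong : ∀ {a b} → a ≈S b → shift a ≈S shift b
shift-cong a≈b zero    = refl
shift-cong a≈b (suc j) = a≈b j

shiftN-cong : ∀ n {a b} → a ≈S b → shiftN n a ≈S shiftN n b
shiftN-cong zero    a≈b = a≈b
shiftN-cong (suc n) a≈b = shift-cong (shiftN-cong n a≈b)

shift-⊛ : ∀ a b → (shift a ⊛ b) ≈S shift (a ⊛ b)
shift-⊛ a b zero    = ℚP.*-zeroˡ (b 0)
shift-⊛ a b (suc j) =
  trans (sum-head j (λ i → shift a i ℚ.* b (suc j ∸ i)))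
        (trans (cong (ℚ._+ (a ⊛ b) j) (ℚP.*-zeroˡ (b (suc j)))) (ℚP.+-identityˡ _))

shiftN-⊛ : ∀ n a b → (shiftN n a ⊛ b) ≈S shiftN n (a ⊛ b)
shiftN-⊛ zero    a b j = refl
shiftN-⊛ (suc n) a b   = shift-⊛ (shiftN n a) b ⟫ shift-cong (shiftN-⊛ n a b)

shiftN-coeff : ∀ n a j → shiftN n a (n + j) ≡ a j
shiftN-coeff zero    a j = refl
shiftN-coeff (suc n) a j = shiftN-coeff n a j

powS-shift : ∀ a n → powS (shift a) n ≈S shiftN n (powS a n)
powS-shift a zero    j = refl
powS-shift a (suc n) =
  ⊛-congˡ (shift a) (powS-shift a n) ⟫
  shift-⊛ a (shiftN n A) ⟫
  shift-cong (⊛-comm a (shiftN n A) ⟫ shiftN-⊛ n A a ⟫ shiftN-cong n (⊛-comm A a))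
  where A = powS a n

expm1-factor : expm1S ≈S shift expm1OverT
expm1-factor zero    = refl
expm1-factor (suc j) = refl

lookup-invVec : ∀ n (k : Fin (suc n)) → lookup (invVec n) k ≡ tOverExpm1 (n ∸ toℕ k)
lookup-invVec zero    Fin.zero    = refl
lookup-invVec (suc n) Fin.zero    = refl
lookup-invVec (suc n) (Fin.suc k) = lookup-invVec n k

sumFin-cong : ∀ n {f g : Fin n → ℚ} → (∀ k → f k ≡ g k) → sumFin n f ≡ sumFin n g
sumFin-cong zero    f≡g = refl
sumFin-cong (suc n) f≡g = cong₂ ℚ._+_ (f≡g Fin.zero) (sumFin-cong n (λ k → f≡g (Fin.suc k)))

sumFin-sumℚ : ∀ n (g : ℕ → ℚ) → sumFin (suc n) (λ k → g (toℕ k)) ≡ sumℚ n g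
sumFin-sumℚ zero    g = ℚP.+-identityʳ (g 0)
sumFin-sumℚ (suc n) g =
  trans (cong (g 0 ℚ.+_) (sumFin-sumℚ n (λ i → g (suc i)))) (sym (sum-head n g))

tOverExpm1-recursion : ∀ n →
  tOverExpm1 (suc n) ≡ ℚ.- sumℚ n (λ i → expm1OverT (suc i) ℚ.* tOverExpm1 (n ∸ i))
tOverExpm1-recursion n = cong ℚ.-_ (trans
  (sumFin-cong (suc n) (λ k → cong (expm1OverT (suc (toℕ k)) ℚ.*_) (lookup-invVec n k)))
  (sumFin-sumℚ n (λ i → expm1OverT (suc i) ℚ.* tOverExpm1 (n ∸ i))))

tOverExpm1-inverse : (expm1OverT ⊛ tOverExpm1) ≈S oneS
tOverExpm1-inverse zero    = refl
tOverExpm1-inverse (suc n) = begin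
  sumℚ (suc n) (λ i → expm1OverT i ℚ.* tOverExpm1 (suc n ∸ i))
    ≡⟨ sum-head n _ ⟩
  expm1OverT 0 ℚ.* tOverExpm1 (suc n) ℚ.+ rest
    ≡⟨ cong (λ z → expm1OverT 0 ℚ.* z ℚ.+ rest) (tOverExpm1-recursion n) ⟩
  1ℚ ℚ.* (ℚ.- rest) ℚ.+ rest
    ≡⟨ cong (ℚ._+ rest) (ℚP.*-identityˡ (ℚ.- rest)) ⟩
  (ℚ.- rest) ℚ.+ rest
    ≡⟨ ℚP.+-inverseˡ rest ⟩
  0ℚ ∎
  where
  open ≡-Reasoning
  rest : ℚ
  rest = sumℚ n (λ i → expm1OverT (suc i) ℚ.* tOverExpm1 (n ∸ i))

expm1-powers-cancel : ∀ n m (Y : Series) →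
  (powS expm1S n ⊛ (powS tOverExpm1 n ⊛ Y)) (n + m) ≡ Y m
expm1-powers-cancel n m Y = begin
  (powS expm1S n ⊛ (B ⊛ Y)) (n + m)
    ≡⟨ ⊛-congʳ (B ⊛ Y) (powS-cong n expm1-factor ⟫ powS-shift expm1OverT n) (n + m) ⟩
  (shiftN n A ⊛ (B ⊛ Y)) (n + m)
    ≡⟨ shiftN-⊛ n A (B ⊛ Y) (n + m) ⟩
  shiftN n (A ⊛ (B ⊛ Y)) (n + m)
    ≡⟨ shiftN-coeff n (A ⊛ (B ⊛ Y)) m ⟩
  (A ⊛ (B ⊛ Y)) m
    ≡⟨ (symS (⊛-assoc A B Y) ⟫ ⊛-congʳ Y (powS-inverse n tOverExpm1-inverse) ⟫ ⊛-identityˡ Y) m ⟩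
  Y m ∎
  where
  open ≡-Reasoning
  A B : Series
  A = powS expm1OverT n
  B = powS tOverExpm1 n

convolution-term : ∀ {N v} n x → v ≤ N →
  fromℕ (N C v) ℚ.* (stirling2 v n ℚ.* bernoulliPoly n (N ∸ v) x)
    ≡ (fromℕ (N !) ℚ.* invFact n) ℚ.* (powS expm1S n v ℚ.* (powS tOverExpm1 n ⊛ expS x) (N ∸ v))
convolution-term {N} {v} n x v≤N = begin
  cv ℚ.* ((fv ℚ.* (i ℚ.* e)) ℚ.* (fw ℚ.* z))
    ≡⟨ solve 6 (λ cv fv fw i e z → cv :* ((fv :* (i :* e)) :* (fw :* z))
                                   := ((cv :* (fv :* fw)) :* i) :* (e :* z)) refl cv fv fw i e z ⟩
  ((cv ℚ.* (fv ℚ.* fw)) ℚ.* i) ℚ.* (e ℚ.* z)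
    ≡⟨ cong (λ q → (q ℚ.* i) ℚ.* (e ℚ.* z)) factorials ⟩
  (fromℕ (N !) ℚ.* i) ℚ.* (e ℚ.* z) ∎
  where
  open ≡-Reasoning
  cv fv fw i e z : ℚ
  cv = fromℕ (N C v)
  fv = fromℕ (v !)
  fw = fromℕ ((N ∸ v) !)
  i  = invFact n
  e  = powS expm1S n v
  z  = (powS tOverExpm1 n ⊛ expS x) (N ∸ v)
  factorials : cv ℚ.* (fv ℚ.* fw) ≡ fromℕ (N !)
  factorials = begin
    cv ℚ.* (fv ℚ.* fw)                     ≡⟨ cong (cv ℚ.*_) (sym (fromℕ-* (v !) ((N ∸ v) !))) ⟩
    cv ℚ.* fromℕ (v ! ℕ.* (N ∸ v) !)       ≡⟨ sym (fromℕ-* (N C v) _) ⟩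
    fromℕ ((N C v) ℕ.* (v ! ℕ.* (N ∸ v) !)) ≡⟨ cong fromℕ (binomial-factorials v≤N) ⟩
    fromℕ (N !)                            ∎

factorial-quotient : ∀ m n → fromℕ ((m + n) !) ℚ.* invFact n ≡ fromℕ ((m + n) C n) ℚ.* fromℕ (m !)
factorial-quotient m n = begin
  fromℕ (N !) ℚ.* i
    ≡⟨ cong (ℚ._* i) N!-split ⟩
  (Cq ℚ.* (fn ℚ.* fm)) ℚ.* i
    ≡⟨ solve 4 (λ Cq fn fm i → (Cq :* (fn :* fm)) :* i := (Cq :* fm) :* (i :* fn)) refl Cq fn fm i ⟩
  (Cq ℚ.* fm) ℚ.* (i ℚ.* fn)
    ≡⟨ cong ((Cq ℚ.* fm) ℚ.*_) (invFact-inverse n) ⟩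
  (Cq ℚ.* fm) ℚ.* 1ℚ
    ≡⟨ ℚP.*-identityʳ _ ⟩
  Cq ℚ.* fm ∎
  where
  open ≡-Reasoning
  N : ℕ
  i Cq fn fm : ℚ
  N  = m + n
  i  = invFact n
  Cq = fromℕ (N C n)
  fn = fromℕ (n !)
  fm = fromℕ (m !)
  N!-split : fromℕ (N !) ≡ Cq ℚ.* (fn ℚ.* fm)
  N!-split = begin
    fromℕ (N !)                              ≡⟨ cong fromℕ (sym (binomial-factorials (ℕP.m≤n+m n m))) ⟩
    fromℕ ((N C n) ℕ.* (n ! ℕ.* (N ∸ n) !))  ≡⟨ cong (λ z → fromℕ ((N C n) ℕ.* (n ! ℕ.* z !))) (ℕP.m+n∸n≡m m n) ⟩
    fromℕ ((N C n) ℕ.* (n ! ℕ.* m !))        ≡⟨ trans (fromℕ-* (N C n) _) (cong (Cq ℚ.*_) (fromℕ-* (n !) (m !))) ⟩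
    Cq ℚ.* (fn ℚ.* fm)                       ∎

stirling-bernoulli-convolution : ∀ m n x →
  sumℚ (m + n) (λ v → fromℕ ((m + n) C v) ℚ.* (stirling2 v n ℚ.* bernoulliPoly n ((m + n) ∸ v) x))
    ≡ fromℕ ((m + n) C n) ℚ.* powℚ x m
stirling-bernoulli-convolution m n x = begin
  sumℚ N (λ v → fromℕ (N C v) ℚ.* (stirling2 v n ℚ.* bernoulliPoly n (N ∸ v) x))
    ≡⟨ sum-cong N (λ v v≤N → convolution-term n x v≤N) ⟩
  sumℚ N (λ v → K ℚ.* (E v ℚ.* Z (N ∸ v)))
    ≡⟨ sym (sum-*ˡ N K (λ v → E v ℚ.* Z (N ∸ v))) ⟩
  K ℚ.* (E ⊛ Z) (m + n)
    ≡⟨ cong (λ j → K ℚ.* (E ⊛ Z) j) (ℕP.+-comm m n) ⟩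
  K ℚ.* (E ⊛ Z) (n + m)
    ≡⟨ cong (K ℚ.*_) (expm1-powers-cancel n m (expS x)) ⟩
  K ℚ.* (powℚ x m ℚ.* invFact m)
    ≡⟨ cong (ℚ._* (powℚ x m ℚ.* invFact m)) (factorial-quotient m n) ⟩
  (Cq ℚ.* fm) ℚ.* (powℚ x m ℚ.* invFact m)
    ≡⟨ solve 4 (λ Cq fm xm im → (Cq :* fm) :* (xm :* im) := (Cq :* xm) :* (im :* fm))
             refl Cq fm (powℚ x m) (invFact m) ⟩
  (Cq ℚ.* powℚ x m) ℚ.* (invFact m ℚ.* fm)
    ≡⟨ cong ((Cq ℚ.* powℚ x m) ℚ.*_) (invFact-inverse m) ⟩
  (Cq ℚ.* powℚ x m) ℚ.* 1ℚ
    ≡⟨ ℚP.*-identityʳ _ ⟩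
  Cq ℚ.* powℚ x m ∎
  where
  open ≡-Reasoning
  N : ℕ
  K Cq fm : ℚ
  E Z : Series
  N  = m + n
  K  = fromℕ (N !) ℚ.* invFact n
  E  = powS expm1S n
  Z  = powS tOverExpm1 n ⊛ expS x
  Cq = fromℕ (N C n)
  fm = fromℕ (m !)

theorem14-coefficient : (m n p k v : ℕ) → ℚ
theorem14-coefficient m n p k v =
  (fromℕ (((n C k) ℕ.^ p) ℕ.* ((m + n) C v)) ℚ.* (invℕ ((m + n) C n) ℚ.* invFact n))
    ℚ.* (stirling2 v n ℚ.* bernoulliPoly n ((m + n) ∸ v) (fromℕ k))

theorem14-inner-sum : ∀ m n p k →
  sumℚ (m + n) (theorem14-coefficient m n p k)
    ≡ invFact n ℚ.* fromℕ (((n C k) ℕ.^ p) ℕ.* (k ℕ.^ m))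
theorem14-inner-sum m n p k = begin
  sumℚ N (theorem14-coefficient m n p k)
    ≡⟨ sum-cong N (λ v _ → split-constant v) ⟩
  sumℚ N (λ v → (P ℚ.* (a ℚ.* i)) ℚ.* conv v)
    ≡⟨ sym (sum-*ˡ N (P ℚ.* (a ℚ.* i)) conv) ⟩
  (P ℚ.* (a ℚ.* i)) ℚ.* sumℚ N conv
    ≡⟨ cong ((P ℚ.* (a ℚ.* i)) ℚ.*_) (stirling-bernoulli-convolution m n (fromℕ k)) ⟩
  (P ℚ.* (a ℚ.* i)) ℚ.* (Cq ℚ.* km)
    ≡⟨ solve 5 (λ P a i Cq km → (P :* (a :* i)) :* (Cq :* km) := (i :* (P :* km)) :* (a :* Cq))
             refl P a i Cq km ⟩
  (i ℚ.* (P ℚ.* km)) ℚ.* (a ℚ.* Cq)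
    ≡⟨ cong ((i ℚ.* (P ℚ.* km)) ℚ.*_) (invℕ-inverse (N C n) (binomial-nonzero (ℕP.m≤n+m n m))) ⟩
  (i ℚ.* (P ℚ.* km)) ℚ.* 1ℚ
    ≡⟨ ℚP.*-identityʳ _ ⟩
  i ℚ.* (P ℚ.* km)
    ≡⟨ cong (i ℚ.*_) (sym (trans (fromℕ-* ((n C k) ℕ.^ p) (k ℕ.^ m)) (cong (P ℚ.*_) (fromℕ-^ k m)))) ⟩
  i ℚ.* fromℕ (((n C k) ℕ.^ p) ℕ.* (k ℕ.^ m)) ∎
  where
  open ≡-Reasoning
  N : ℕ
  P a i Cq km : ℚ
  N  = m + n
  P  = fromℕ ((n C k) ℕ.^ p)
  a  = invℕ (N C n)
  i  = invFact n
  Cq = fromℕ (N C n)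
  km = powℚ (fromℕ k) m
  conv : ℕ → ℚ
  conv v = fromℕ (N C v) ℚ.* (stirling2 v n ℚ.* bernoulliPoly n (N ∸ v) (fromℕ k))
  split-constant : ∀ v → theorem14-coefficient m n p k v ≡ (P ℚ.* (a ℚ.* i)) ℚ.* conv v
  split-constant v = begin
    fromℕ (((n C k) ℕ.^ p) ℕ.* (N C v)) ℚ.* (a ℚ.* i) ℚ.* sb
      ≡⟨ cong (λ q → q ℚ.* (a ℚ.* i) ℚ.* sb) (fromℕ-* ((n C k) ℕ.^ p) (N C v)) ⟩
    (P ℚ.* cv) ℚ.* (a ℚ.* i) ℚ.* sb
      ≡⟨ solve 4 (λ P cv ai sb → (P :* cv) :* ai :* sb := (P :* ai) :* (cv :* sb))
               refl P cv (a ℚ.* i) sb ⟩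
    (P ℚ.* (a ℚ.* i)) ℚ.* (cv ℚ.* sb) ∎
    where
    cv sb : ℚ
    cv = fromℕ (N C v)
    sb = stirling2 v n ℚ.* bernoulliPoly n (N ∸ v) (fromℕ k)

-- Transport to a commutative ring R receiving ℚ; only the additivity and
-- multiplicativity of ι are needed.

module Transport {c ℓ : Level} (R : CommutativeRing c ℓ) (ι : ℚ → CommutativeRing.Carrier R)
  (ι-homo : IsRingHomomorphism +-*-rawRing (CommutativeRing.rawRing R) ι) where
  open CommutativeRing R renaming (refl to ≈-refl; sym to ≈-sym; trans to ≈-trans)
  open RingOps R
  open IsRingHomomorphism ι-homo using (+-homo; *-homo)
  open SetoidReasoning setoid

  sumR-cong : ∀ n {f g} → (∀ i → f i ≈ g i) → sumR n f ≈ sumR n g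
  sumR-cong zero    f≈g = f≈g 0
  sumR-cong (suc n) f≈g = +-cong (sumR-cong n f≈g) (f≈g (suc n))

  sumR-*ˡ : ∀ n f x → x * sumR n f ≈ sumR n (λ i → x * f i)
  sumR-*ˡ zero    f x = ≈-refl
  sumR-*ˡ (suc n) f x = ≈-trans (distribˡ x (sumR n f) (f (suc n))) (+-cong (sumR-*ˡ n f x) ≈-refl)

  sumR-*ʳ : ∀ n f x → sumR n f * x ≈ sumR n (λ i → f i * x)
  sumR-*ʳ zero    f x = ≈-refl
  sumR-*ʳ (suc n) f x = ≈-trans (distribʳ x (sumR n f) (f (suc n))) (+-cong (sumR-*ʳ n f x) ≈-refl)

  ι-sum : ∀ n f → ι (sumℚ n f) ≈ sumR n (λ i → ι (f i))
  ι-sum zero    f = ≈-refl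
  ι-sum (suc n) f = ≈-trans (+-homo (sumℚ n f) (f (suc n))) (+-cong (ι-sum n f) ≈-refl)

  collapse-inner-sums : ∀ n N (g : ℕ → ℕ → ℚ) (c : ℚ) (h : ℕ → ℚ) (w : ℕ → Carrier) →
    (∀ k → sumℚ N (g k) ≡ c ℚ.* h k) →
    sumR n (λ k → sumR N (λ v → ι (g k v) * w k)) ≈ ι c * sumR n (λ k → ι (h k) * w k)
  collapse-inner-sums n N g c h w inner = begin
    sumR n (λ k → sumR N (λ v → ι (g k v) * w k))
      ≈⟨ sumR-cong n (λ k → ≈-sym (sumR-*ʳ N (λ v → ι (g k v)) (w k))) ⟩
    sumR n (λ k → sumR N (λ v → ι (g k v)) * w k)
      ≈⟨ sumR-cong n (λ k → *-cong (≈-sym (ι-sum N (g k))) ≈-refl) ⟩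
    sumR n (λ k → ι (sumℚ N (g k)) * w k)
      ≈⟨ sumR-cong n (λ k → *-cong (reflexive (cong ι (inner k))) ≈-refl) ⟩
    sumR n (λ k → ι (c ℚ.* h k) * w k)
      ≈⟨ sumR-cong n (λ k → ≈-trans (*-cong (*-homo c (h k)) ≈-refl) (*-assoc _ _ _)) ⟩
    sumR n (λ k → ι c * (ι (h k) * w k))
      ≈⟨ sumR-*ˡ n (λ k → ι (h k) * w k) (ι c) ⟨
    ι c * sumR n (λ k → ι (h k) * w k) ∎

mainTheorem14 : {c ℓ : Level} (R : CommutativeRing c ℓ) (ι : ℚ → CommutativeRing.Carrier R) →
    IsRingHomomorphism +-*-rawRing (CommutativeRing.rawRing R) ι →
    (m n p : ℕ) → 1 ≤ n → (lam : CommutativeRing.Carrier R) →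
    CommutativeRing._≈_ R (y6 R ι m n lam p)
    (RingOps.sumR R n (λ k → RingOps.sumR R (m + n) (λ v →
    CommutativeRing._*_ R
    (ι ((fromℕ (((n C k) ℕ.^ p) ℕ.* ((m + n) C v))
    ℚ.* (invℕ ((m + n) C n) ℚ.* invFact n))
    ℚ.* (stirling2 v n ℚ.* bernoulliPoly n ((m + n) ∸ v) (fromℕ k))))
    (RingOps.powR R lam k))))
mainTheorem14 R ι ι-homo m n p _ lam =
  CommutativeRing.sym R
    (collapse-inner-sums n (m + n) (theorem14-coefficient m n p) (invFact n)
       (λ k → fromℕ (((n C k) ℕ.^ p) ℕ.* (k ℕ.^ m))) (RingOps.powR R lam)
       (theorem14-inner-sum m n p))
  where open Transport R ι ι-homo
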